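{- Deterministic, length-preserving two-stack machine uniform boundedness many-one reduces to confluent, simple two-stack machine uniform boundedness; that is, there is a computable function mapping each deterministic, length-preserving two-stack machine $S$ to a confluent, simple two-stack machine $S'$ such that $S$ is uniformly bounded if and only if $S'$ is uniformly bounded.
   Context: Fix a countably infinite set $\mathbb{S}$ of states. A two-stack machine $S$ is a finite list of instructions $\langle A,p,B\rangle\to\langle A',q,B'\rangle$ with $A,B,A',B'\in\{0,1\}^*$ and $p,q\in\mathbb{S}$. A configuration is $\langle A,p,B\rangle$ with $A,B\in\{0,1\}^*$ and $p\in\mathbb{S}$. Step relation $\longrightarrow_S$: if $(\langle A,p,B\rangle\to\langle A',q,B'\rangle)\in S$, then for all $C,D\in\{0,1\}^*$, $\langle CA,p,BD\rangle\longrightarrow_S\langle CA',q,B'D\rangle$. $\longrightarrow_S^*$ is its reflexive transitive closure. $S$ is uniformly bounded if there is $n\in\mathbb{N}$ such that from every configuration at most $n$ distinct configurations are reachable. $S$ is length-preserving if each instruction satisfies $0<|A|+|B|=|A'|+|B'|$. $S$ is deterministic if $X\longrightarrow_S Y$ and $X\longrightarrow_S Y'$ imply $Y=Y'$. $S$ is simple if each instruction satisfies $1=|A|+|B|=|A'|+|B'|=|A|+|A'|=|B|+|B'|$. $S$ is confluent if whenever $X\longrightarrow_S^*Y_1$ and $X\longrightarrow_S^*Y_2$ there is $Z$ with $Y_1\longrightarrow_S^*Z$ and $Y_2\longrightarrow_S^*Z$. Many-one reduction: a computable $f$ with $P(x)\iff Q(f(x))$ for all inputs $x$. -}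

module Defs where

open import Data.Bool using (Bool)
open import Data.Nat using (ℕ; _+_; _<_; _≤_)
open import Data.List using (List; _++_; length)
open import Data.List.Membership.Propositional using (_∈_)
open import Data.List.Relation.Unary.All using (All)
open import Data.List.Relation.Unary.Unique.Propositional using (Unique)
open import Data.Product using (Σ; ∃; _×_; _,_)
open import Relation.Binary.PropositionalEquality using (_≡_)
open import Relation.Binary.Construct.Closure.ReflexiveTransitive using (Star)

-- Stack contents: words over {0,1}, with 0 ↦ false, 1 ↦ true.
Word : Set
Word = List Bool

-- The countably infinite set of states 𝕊 is taken to be ℕ.
State : Set
State = ℕ

record Config : Set where
  constructor ⟨_,_,_⟩
  field
    left  : Word
    state : State
    right : Word

record Instr : Set where
  constructor _⇒_
  field
    lhs : Config
    rhs : Config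

Machine : Set
Machine = List Instr

data Step (S : Machine) : Config → Config → Set where
  step : ∀ {A p B A' q B'} (C D : Word) →
         (⟨ A , p , B ⟩ ⇒ ⟨ A' , q , B' ⟩) ∈ S →
         Step S ⟨ C ++ A , p , B ++ D ⟩ ⟨ C ++ A' , q , B' ++ D ⟩

Steps : Machine → Config → Config → Set
Steps S = Star (Step S)

-- Uniformly bounded: some n such that from every configuration at most n
-- distinct configurations are reachable (every duplicate-free list of
-- reachable configurations has length ≤ n).
UniformlyBounded : Machine → Set
UniformlyBounded S =
  ∃ λ (n : ℕ) → ∀ (X : Config) (Ys : List Config) →
    All (Steps S X) Ys → Unique Ys → length Ys ≤ n

lenL : Config → ℕ
lenL ⟨ A , _ , _ ⟩ = length A

lenR : Config → ℕ
lenR ⟨ _ , _ , B ⟩ = length B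

LengthPreservingInstr : Instr → Set
LengthPreservingInstr (l ⇒ r) = (0 < lenL l + lenR l) × (lenL l + lenR l ≡ lenL r + lenR r)

LengthPreserving : Machine → Set
LengthPreserving S = All LengthPreservingInstr S

SimpleInstr : Instr → Set
SimpleInstr (l ⇒ r) =
  (1 ≡ lenL l + lenR l) × (lenL l + lenR l ≡ lenL r + lenR r) ×
  (lenL r + lenR r ≡ lenL l + lenL r) × (lenL l + lenL r ≡ lenR l + lenR r)

Simple : Machine → Set
Simple S = All SimpleInstr S

Deterministic : Machine → Set
Deterministic S = ∀ {X Y Y'} → Step S X Y → Step S X Y' → Y ≡ Y'

Confluent : Machine → Set
Confluent S = ∀ {X Y₁ Y₂} → Steps S X Y₁ → Steps S X Y₂ →
  ∃ λ Z → Steps S Y₁ Z × Steps S Y₂ Z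

-- The simulator is a one-head machine whose tape halves are the two stacks of S: each of its
-- instructions moves one symbol across the head, so it is simple, and it is deterministic, hence
-- confluent. It executes S in cycles. From the embedding of ⟨ L , p , R ⟩, with the head between
-- L and R, it seeks `radius` cells to the left, scans a window of twice that width, rewrites the
-- window with the first instruction of S that applies at its centre, and moves back to the new
-- boundary. As `radius` exceeds the size of every left-hand side, the window contains every redex
-- at the head; as S is length-preserving, the window keeps its width and a cycle lasts at most
-- `period` steps.
--
-- If at most n configurations are reachable in S, every run of the simulator reaches the start of
-- a cycle within a bounded number of steps (a rank argument) and from then on stays within
-- `period` steps of the embedding of a configuration reachable in S. Conversely, padding both
-- stacks with `radius` zeros lets every step of S be completed by a cycle, and determinism of S
-- makes the instruction chosen by the simulator the one S used; since the padded embedding is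
-- injective on reachable configurations, a bound for the simulator bounds S.

module Submission where

open import Defs
open import Data.Bool using (Bool; true; false)
import Data.Bool.Properties as Bool
open import Data.List using (List; []; _∷_; _ʳ++_; _++_; length; reverse; map; take; drop; replicate; concatMap; upTo)
import Data.List.Properties as List
open import Data.List.Properties
  using ( ∷-injective; ++-assoc; ++-identityʳ; ++-cancelˡ; ++-cancelʳ; reverse-++; reverse-involutive; reverse-injective
        ; unfold-reverse; ʳ++-defn; length-++; length-take; length-drop; length-reverse; length-map; length-replicate
        ; take++drop≡id)
open import Data.List.Extrema.Nat using (max; xs≤max)
open import Data.List.Membership.Propositional using (_∈_; find; lose)
open import Data.List.Membership.Propositional.Properties using (∈-++⁺ˡ; ∈-++⁺ʳ; ∈-++⁻; ∈-map⁺; ∈-concatMap⁺; ∈-concatMap⁻; ∈-upTo⁺)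
open import Data.List.Relation.Binary.Pointwise using (Pointwise; []; _∷_; Pointwise-length)
open import Data.List.Relation.Binary.Sublist.Propositional using ([]; _∷_; _∷ʳ_) renaming (_⊆_ to _⊑_)
open import Data.List.Relation.Binary.Sublist.Propositional.Properties using (All-resp-⊆)
open import Data.List.Relation.Unary.All as All using (All; []; _∷_)
open import Data.List.Relation.Unary.All.Properties as All using ()
open import Data.List.Relation.Unary.AllPairs using ([]; _∷_)
open import Data.List.Relation.Unary.Any using (here; there)
open import Data.List.Relation.Unary.Unique.Propositional using (Unique)
open import Data.Maybe as Maybe using (Maybe; just; nothing; _>>=_; maybe′)
open import Data.Maybe.Properties using (just-injective)
open import Data.Nat as ℕ using (ℕ; zero; suc; _+_; _*_; _∸_; _≤_; _<_; _≟_; z≤n; s≤s)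
open import Data.Nat.Induction using (<-wellFounded)
open import Data.Nat.Properties
  using ( +-assoc; +-suc; +-identityʳ; +-mono-≤; +-monoʳ-≤; +-monoʳ-<; ≤-refl; ≤-reflexive; ≤-trans; ≤-<-trans; ≤-pred
        ; m≤m+n; m≤n+m; n≤1+n; n<1+n; m≤n⇒m≤1+n; m≤n⇒m<n∨m≡n; m+[n∸m]≡n; m∸[m∸n]≡n; m≤n⇒m⊓n≡m; ∸-monoʳ-<
        ; ≮⇒≥; ≰⇒>; 0≢1+n; suc-injective; _≤?_; _<?_; module ≤-Reasoning)
open import Data.Product using (Σ; ∃; ∃₂; _×_; _,_; proj₁; proj₂)
import Data.Product.Properties as Product
open import Data.Sum using (_⊎_; inj₁; inj₂)
open import Function using (_∘_)
open import Function.Bundles using (_⇔_; mk⇔)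
open import Induction.WellFounded using (Acc; acc)
open import Relation.Binary.Construct.Closure.ReflexiveTransitive using (ε; _◅_; _◅◅_)
open import Relation.Binary.Definitions using (DecidableEquality)
open import Relation.Binary.PropositionalEquality
  using (_≡_; _≢_; refl; sym; trans; cong; cong₂; subst; subst₂; module ≡-Reasoning)
open import Relation.Nullary using (Dec; yes; no; contradiction)
open import Relation.Nullary.Decidable using (map′)
open import Relation.Unary using (_⊆_; _∪_)

-- Counting distinct elements

-- UniformlyBounded S unfolds to ∃ λ n → ∀ X → AtMost n (Steps S X).
AtMost : {A : Set} → ℕ → (A → Set) → Set
AtMost n P = ∀ Ys → All P Ys → Unique Ys → length Ys ≤ n

module _ {A : Set} where

  AtMost-⊆ : {P Q : A → Set} {n : ℕ} → P ⊆ Q → AtMost n Q → AtMost n P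
  AtMost-⊆ P⊆Q bound Ys pYs = bound Ys (All.map P⊆Q pYs)

  AtMost-one : {P : A → Set} → (∀ {x y} → P x → P y → x ≡ y) → AtMost 1 P
  AtMost-one P-unique []          _               _                 = z≤n
  AtMost-one P-unique (_ ∷ [])    _               _                 = s≤s z≤n
  AtMost-one P-unique (_ ∷ _ ∷ _) (px ∷ py ∷ _)   ((x≢y ∷ _) ∷ _)   = contradiction (P-unique px py) x≢y

  Unique-resp-⊑ : {xs ys : List A} → xs ⊑ ys → Unique ys → Unique xs
  Unique-resp-⊑ []            []          = []
  Unique-resp-⊑ (_ ∷ʳ xs⊑ys)  (_ ∷ u)     = Unique-resp-⊑ xs⊑ys u
  Unique-resp-⊑ (refl ∷ xs⊑ys) (y∉ys ∷ u) = All-resp-⊆ xs⊑ys y∉ys ∷ Unique-resp-⊑ xs⊑ys u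

  record Split (P Q : A → Set) (Ys : List A) : Set where
    field
      Ps Qs   : List A
      Ps⊑Ys   : Ps ⊑ Ys
      Qs⊑Ys   : Qs ⊑ Ys
      all-P   : All P Ps
      all-Q   : All Q Qs
      length≡ : length Ys ≡ length Ps + length Qs

  split : {P Q : A → Set} → ∀ Ys → All (P ∪ Q) Ys → Split P Q Ys
  split [] [] = record { Ps = [] ; Qs = [] ; Ps⊑Ys = [] ; Qs⊑Ys = [] ; all-P = [] ; all-Q = [] ; length≡ = refl }
  split (y ∷ Ys) (inj₁ py ∷ pYs) = record
    { Ps = y ∷ Ps ; Qs = Qs ; Ps⊑Ys = refl ∷ Ps⊑Ys ; Qs⊑Ys = y ∷ʳ Qs⊑Ys
    ; all-P = py ∷ all-P ; all-Q = all-Q ; length≡ = cong suc length≡ }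
    where open Split (split Ys pYs)
  split (y ∷ Ys) (inj₂ qy ∷ pYs) = record
    { Ps = Ps ; Qs = y ∷ Qs ; Ps⊑Ys = y ∷ʳ Ps⊑Ys ; Qs⊑Ys = refl ∷ Qs⊑Ys
    ; all-P = all-P ; all-Q = qy ∷ all-Q ; length≡ = trans (cong suc length≡) (sym (+-suc (length Ps) (length Qs))) }
    where open Split (split Ys pYs)

  AtMost-∪ : {P Q : A → Set} {m n : ℕ} → AtMost m P → AtMost n Q → AtMost (m + n) (P ∪ Q)
  AtMost-∪ boundP boundQ Ys pYs uYs =
    subst (_≤ _) (sym length≡)
      (+-mono-≤ (boundP Ps all-P (Unique-resp-⊑ Ps⊑Ys uYs)) (boundQ Qs all-Q (Unique-resp-⊑ Qs⊑Ys uYs)))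
    where open Split (split Ys pYs)

  AtMost-⋃< : {P : ℕ → A → Set} {n : ℕ} (N : ℕ) → (∀ j → j < N → AtMost n (P j)) →
              AtMost (N * n) (λ y → ∃ λ j → j < N × P j y)
  AtMost-⋃< zero    _     []      _                  _ = z≤n
  AtMost-⋃< zero    _     (_ ∷ _) ((_ , () , _) ∷ _) _
  AtMost-⋃< {P} (suc N) bound = AtMost-⊆ last-or-earlier
    (AtMost-∪ (bound N ≤-refl) (AtMost-⋃< N (λ j j<N → bound j (m≤n⇒m≤1+n j<N))))
    where
    last-or-earlier : (λ y → ∃ λ j → j < suc N × P j y) ⊆ (P N ∪ λ y → ∃ λ j → j < N × P j y)
    last-or-earlier (j , j<1+N , pj) with m≤n⇒m<n∨m≡n (≤-pred j<1+N)
    ... | inj₁ j<N  = inj₂ (j , j<N , pj)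
    ... | inj₂ refl = inj₁ pj

  AtMost-⋃unique : {Z : Set} {Q : Z → Set} {P : Z → A → Set} {n : ℕ} →
                   (∀ {z z′} → Q z → Q z′ → z ≡ z′) → (∀ {z} → Q z → AtMost n (P z)) →
                   AtMost n (λ y → ∃ λ z → Q z × P z y)
  AtMost-⋃unique Q-unique bound []       []                  _ = z≤n
  AtMost-⋃unique {Q = Q} {P = P} Q-unique bound (y ∷ Ys) ((z , qz , pzy) ∷ pYs) =
    bound qz (y ∷ Ys) (pzy ∷ All.map at-z pYs)
    where
    at-z : (λ y′ → ∃ λ z′ → Q z′ × P z′ y′) ⊆ P z
    at-z (z′ , qz′ , pz′y′) = subst (λ k → P k _) (Q-unique qz′ qz) pz′y′

module _ {A B : Set} where

  Functional : (A → B → Set) → Set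
  Functional R = ∀ {x y y′} → R x y → R x y′ → y ≡ y′

  AtMost-image : {P : A → Set} {R : A → B → Set} {n : ℕ} → Functional R → AtMost n P →
                 AtMost n (λ y → ∃ λ x → P x × R x y)
  AtMost-image {P} {R} {n} R-functional bound Ys imYs uYs =
    let xs , xsRYs , pxs , uxs = preimages imYs uYs in
    subst (_≤ n) (Pointwise-length xsRYs) (bound xs pxs uxs)
    where
    preimages : ∀ {Ys} → All (λ y → ∃ λ x → P x × R x y) Ys → Unique Ys →
                ∃ λ xs → Pointwise R xs Ys × All P xs × Unique xs
    preimages [] [] = [] , [] , [] , []
    preimages ((x , px , rxy) ∷ imYs) (y∉Ys ∷ uYs) =
      let xs , xsRYs , pxs , uxs = preimages imYs uYs in
      x ∷ xs , rxy ∷ xsRYs , px ∷ pxs , distinct xsRYs y∉Ys ∷ uxs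
      where
      distinct : ∀ {xs Ys} → Pointwise R xs Ys → All (_ ≢_) Ys → All (x ≢_) xs
      distinct [] [] = []
      distinct (rx′y′ ∷ xsRYs) (y≢y′ ∷ y∉Ys) =
        (λ { refl → y≢y′ (R-functional rxy rx′y′) }) ∷ distinct xsRYs y∉Ys

  AtMost-preimage : {P : A → Set} {Q : B → Set} {n : ℕ} (f : A → B) → (∀ {x} → P x → Q (f x)) →
                    (∀ {x y} → P x → P y → f x ≡ f y → x ≡ y) → AtMost n Q → AtMost n P
  AtMost-preimage {P} {n = n} f P⇒Q∘f f-injective bound Ys pYs uYs =
    subst (_≤ n) (length-map f Ys) (bound (map f Ys) (All.map⁺ (All.map P⇒Q∘f pYs)) (distinct-images pYs uYs))
    where
    distinct-images : ∀ {Ys} → All P Ys → Unique Ys → Unique (map f Ys)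
    distinct-images []         []          = []
    distinct-images (px ∷ pYs) (x∉Ys ∷ uYs) =
      All.map⁺ (All.zipWith (λ (py , x≢y) fx≡fy → x≢y (f-injective px py fx≡fy)) (pYs , x∉Ys))
      ∷ distinct-images pYs uYs

module _ {A : Set} where

  splitAtEnd : ∀ n (xs : List A) → n ≤ length xs → ∃₂ λ ys zs → xs ≡ ys ++ zs × length zs ≡ n
  splitAtEnd n xs n≤∣xs∣ =
    take (length xs ∸ n) xs , drop (length xs ∸ n) xs , sym (take++drop≡id (length xs ∸ n) xs) ,
    trans (length-drop (length xs ∸ n) xs) (m∸[m∸n]≡n n≤∣xs∣)

  splitAtStart : ∀ n (xs : List A) → n ≤ length xs → ∃₂ λ ys zs → xs ≡ ys ++ zs × length ys ≡ n
  splitAtStart n xs n≤∣xs∣ =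
    take n xs , drop n xs , sym (take++drop≡id n xs) , trans (length-take n xs) (m≤n⇒m⊓n≡m n≤∣xs∣)

  take-++-length : ∀ (xs ys : List A) → take (length xs) (xs ++ ys) ≡ xs
  take-++-length []       ys = refl
  take-++-length (x ∷ xs) ys = cong (x ∷_) (take-++-length xs ys)

  drop-++-length : ∀ (xs ys : List A) → drop (length xs) (xs ++ ys) ≡ ys
  drop-++-length []       ys = refl
  drop-++-length (x ∷ xs) ys = drop-++-length xs ys

  reverse-++⁻ : ∀ {xs ys zs : List A} → reverse xs ≡ ys ++ zs → xs ≡ reverse zs ++ reverse ys
  reverse-++⁻ {xs} {ys} {zs} eq = trans (sym (reverse-involutive xs)) (trans (cong reverse eq) (reverse-++ ys zs))

  reverse-∷-reverse : ∀ x (xs : List A) → reverse (x ∷ reverse xs) ≡ xs ++ x ∷ []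
  reverse-∷-reverse x xs = trans (unfold-reverse x (reverse xs)) (cong (_++ x ∷ []) (reverse-involutive xs))

  reverse-ʳ++ : ∀ (xs ys : List A) → reverse xs ʳ++ ys ≡ xs ++ ys
  reverse-ʳ++ xs ys = trans (ʳ++-defn (reverse xs)) (cong (_++ ys) (reverse-involutive xs))

  ++-prefix : ∀ (ws xs ys zs : List A) → ws ++ xs ≡ ys ++ zs → length ys ≤ length ws →
              ∃ λ vs → ws ≡ ys ++ vs
  ++-prefix ws       xs []       zs eq ∣ys∣≤∣ws∣       = ws , refl
  ++-prefix (w ∷ ws) xs (y ∷ ys) zs eq (s≤s ∣ys∣≤∣ws∣) with ∷-injective eq
  ... | refl , eq′ with ++-prefix ws xs ys zs eq′ ∣ys∣≤∣ws∣
  ...   | vs , refl = vs , refl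

  ++-suffix : ∀ (ws xs ys zs : List A) → ws ++ xs ≡ ys ++ zs → length zs ≤ length xs →
              ∃ λ vs → xs ≡ vs ++ zs
  ++-suffix ws xs ys zs eq ∣zs∣≤∣xs∣
    with vs , eq′ ← ++-prefix (reverse xs) (reverse ws) (reverse zs) (reverse ys)
                     (trans (sym (reverse-++ ws xs)) (trans (cong reverse eq) (reverse-++ ys zs)))
                     (subst₂ _≤_ (sym (length-reverse zs)) (sym (length-reverse xs)) ∣zs∣≤∣xs∣)
    = reverse vs , trans (reverse-++⁻ {xs} {reverse zs} eq′) (cong (reverse vs ++_) (reverse-involutive zs))

module _ {A : Set} (_≟ᴬ_ : DecidableEquality A) where

  prefix? : (xs ys : List A) → Dec (∃ λ zs → ys ≡ xs ++ zs)
  prefix? []       ys       = yes (ys , refl)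
  prefix? (x ∷ xs) []       = no λ ()
  prefix? (x ∷ xs) (y ∷ ys) with x ≟ᴬ y | prefix? xs ys
  ... | yes refl | yes (zs , refl) = yes (zs , refl)
  ... | no x≢y   | _               = no λ { (_ , refl) → x≢y refl }
  ... | yes _    | no ¬prefix      = no λ { (zs , refl) → ¬prefix (zs , refl) }

  suffix? : (xs ys : List A) → Dec (∃ λ zs → ys ≡ zs ++ xs)
  suffix? xs ys = map′ fromPrefix toPrefix (prefix? (reverse xs) (reverse ys))
    where
    fromPrefix : (∃ λ zs → reverse ys ≡ reverse xs ++ zs) → ∃ λ zs → ys ≡ zs ++ xs
    fromPrefix (zs , eq) =
      reverse zs , trans (reverse-++⁻ {xs = ys} {ys = reverse xs} eq) (cong (reverse zs ++_) (reverse-involutive xs))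
    toPrefix : (∃ λ zs → ys ≡ zs ++ xs) → ∃ λ zs → reverse ys ≡ reverse xs ++ zs
    toPrefix (zs , refl) = reverse zs , reverse-++ zs xs

  position : A → List A → ℕ
  position x []       = 0
  position x (y ∷ ys) with x ≟ᴬ y
  ... | yes _ = 0
  ... | no  _ = suc (position x ys)

  position-injective : ∀ {x y ys} → y ∈ ys → position x ys ≡ position y ys → x ≡ y
  position-injective {x} {y} {z ∷ ys} y∈ys eq with x ≟ᴬ z | y ≟ᴬ z
  ... | yes refl | yes refl = refl
  ... | no _     | yes _    = contradiction (sym eq) 0≢1+n
  position-injective (here refl) eq | _ | no y≢z = contradiction refl y≢z
  position-injective (there y∈ys) eq | yes _ | no _ = contradiction eq 0≢1+n
  position-injective (there y∈ys) eq | no _  | no _ = position-injective y∈ys (suc-injective eq)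

∈-concatMap⁺′ : {A B : Set} {f : A → List B} {x : A} {y : B} {xs : List A} → x ∈ xs → y ∈ f x → y ∈ concatMap f xs
∈-concatMap⁺′ {f = f} x∈xs y∈fx = ∈-concatMap⁺ f (lose x∈xs y∈fx)

f≤max-map : {A : Set} (f : A → ℕ) {x : A} {xs : List A} → x ∈ xs → f x ≤ max 0 (map f xs)
f≤max-map f x∈xs = All.lookup (xs≤max 0 (map f _)) (∈-map⁺ f x∈xs)

wordsOfLength : ℕ → List Word
wordsOfLength zero    = [] ∷ []
wordsOfLength (suc n) = map (false ∷_) (wordsOfLength n) ++ map (true ∷_) (wordsOfLength n)

∈-wordsOfLength : ∀ w → w ∈ wordsOfLength (length w)
∈-wordsOfLength []          = here refl
∈-wordsOfLength (false ∷ w) = ∈-++⁺ˡ (∈-map⁺ (false ∷_) (∈-wordsOfLength w))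
∈-wordsOfLength (true ∷ w)  = ∈-++⁺ʳ _ (∈-map⁺ (true ∷_) (∈-wordsOfLength w))

wordsUpTo : ℕ → List Word
wordsUpTo n = concatMap wordsOfLength (upTo (suc n))

∈-wordsUpTo : ∀ {n} w → length w ≤ n → w ∈ wordsUpTo n
∈-wordsUpTo w ∣w∣≤n = ∈-concatMap⁺′ {f = wordsOfLength} (∈-upTo⁺ (s≤s ∣w∣≤n)) (∈-wordsOfLength w)

module _ {S : Machine} where

  deterministic⇒linear : Deterministic S → ∀ {X Y₁ Y₂} → Steps S X Y₁ → Steps S X Y₂ →
                         Steps S Y₁ Y₂ ⊎ Steps S Y₂ Y₁
  deterministic⇒linear det ε               X⟶*Y₂           = inj₁ X⟶*Y₂
  deterministic⇒linear det (X⟶Y ◅ Y⟶*Y₁) ε               = inj₂ (X⟶Y ◅ Y⟶*Y₁)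
  deterministic⇒linear det (X⟶Y ◅ Y⟶*Y₁) (X⟶Y′ ◅ Y′⟶*Y₂) with det X⟶Y X⟶Y′
  ... | refl = deterministic⇒linear det Y⟶*Y₁ Y′⟶*Y₂

  deterministic⇒confluent : Deterministic S → Confluent S
  deterministic⇒confluent det X⟶*Y₁ X⟶*Y₂ with deterministic⇒linear det X⟶*Y₁ X⟶*Y₂
  ... | inj₁ Y₁⟶*Y₂ = _ , Y₁⟶*Y₂ , ε
  ... | inj₂ Y₂⟶*Y₁ = _ , ε , Y₂⟶*Y₁

statesOf : Machine → List State
statesOf = concatMap λ { (⟨ _ , p , _ ⟩ ⇒ ⟨ _ , q , _ ⟩) → p ∷ q ∷ [] }

source∈statesOf : ∀ {S A p B A′ q B′} → (⟨ A , p , B ⟩ ⇒ ⟨ A′ , q , B′ ⟩) ∈ S → p ∈ statesOf S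
source∈statesOf i∈S = ∈-concatMap⁺′ i∈S (here refl)

target∈statesOf : ∀ {S A p B A′ q B′} → (⟨ A , p , B ⟩ ⇒ ⟨ A′ , q , B′ ⟩) ∈ S → q ∈ statesOf S
target∈statesOf i∈S = ∈-concatMap⁺′ i∈S (there (here refl))

step-source : ∀ {S X Y} → Step S X Y → Config.state X ∈ statesOf S
step-source (step _ _ i∈S) = source∈statesOf i∈S

step-target : ∀ {S X Y} → Step S X Y → Config.state Y ∈ statesOf S
step-target (step _ _ i∈S) = target∈statesOf i∈S

fire : Machine → State → Word → Word → Maybe (Word × ℕ × State)
fire []                                     p w z = nothing
fire ((⟨ A , p′ , B ⟩ ⇒ ⟨ A′ , q , B′ ⟩) ∷ S) p w z
  with p′ ≟ p | suffix? Bool._≟_ A w | prefix? Bool._≟_ B z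
... | yes _ | yes (x , _) | yes (y , _) = just ((x ++ A′) ++ (B′ ++ y) , length (x ++ A′) , q)
... | _     | _           | _           = fire S p w z

record Fires (S : Machine) (p : State) (w z u : Word) (s : ℕ) (q : State) : Set where
  field
    A B A′ B′ x y : Word
    instr         : (⟨ A , p , B ⟩ ⇒ ⟨ A′ , q , B′ ⟩) ∈ S
    w≡xA          : w ≡ x ++ A
    z≡By          : z ≡ B ++ y
    u≡xA′B′y      : u ≡ (x ++ A′) ++ (B′ ++ y)
    s≡∣xA′∣       : s ≡ length (x ++ A′)

Fires-there : ∀ {i S p w z u s q} → Fires S p w z u s q → Fires (i ∷ S) p w z u s q
Fires-there fires = record { A = A ; B = B ; A′ = A′ ; B′ = B′ ; x = x ; y = y ; instr = there instr
                           ; w≡xA = w≡xA ; z≡By = z≡By ; u≡xA′B′y = u≡xA′B′y ; s≡∣xA′∣ = s≡∣xA′∣ }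
  where open Fires fires

fire-sound : ∀ S {p w z u s q} → fire S p w z ≡ just (u , s , q) → Fires S p w z u s q
fire-sound ((⟨ A , p′ , B ⟩ ⇒ ⟨ A′ , q′ , B′ ⟩) ∷ S) {p} {w} {z} eq
  with p′ ≟ p | suffix? Bool._≟_ A w | prefix? Bool._≟_ B z
... | yes refl | yes (x , w≡xA) | yes (y , z≡By) with refl ← eq = record
  { x = x ; y = y ; instr = here refl ; w≡xA = w≡xA ; z≡By = z≡By ; u≡xA′B′y = refl ; s≡∣xA′∣ = refl }
... | no _     | _              | _              = Fires-there (fire-sound S eq)
... | yes _    | no _           | _              = Fires-there (fire-sound S eq)
... | yes _    | yes _          | no _           = Fires-there (fire-sound S eq)

fire-complete : ∀ S {p w z A B A′ B′ q x y} → (⟨ A , p , B ⟩ ⇒ ⟨ A′ , q , B′ ⟩) ∈ S →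
                w ≡ x ++ A → z ≡ B ++ y → ∃ λ r → fire S p w z ≡ just r
fire-complete ((⟨ A , p′ , B ⟩ ⇒ _) ∷ S) {p} {w} {z} i∈S w≡xA z≡By
  with p′ ≟ p | suffix? Bool._≟_ A w | prefix? Bool._≟_ B z | i∈S
... | yes _  | yes _      | yes _      | _          = _ , refl
... | no p≢p | _          | _          | here refl  = contradiction refl p≢p
... | yes _  | no ¬suffix | _          | here refl  = contradiction (_ , w≡xA) ¬suffix
... | yes _  | yes _      | no ¬prefix | here refl  = contradiction (_ , z≡By) ¬prefix
... | no _   | _          | _          | there i∈S′ = fire-complete S i∈S′ w≡xA z≡By
... | yes _  | no _       | _          | there i∈S′ = fire-complete S i∈S′ w≡xA z≡By
... | yes _  | yes _      | no _       | there i∈S′ = fire-complete S i∈S′ w≡xA z≡By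

module _ {S : Machine} {p w z u s q} (fires : Fires S p w z u s q) where
  open Fires fires

  Fires-length : LengthPreserving S → length u ≡ length w + length z
  Fires-length lp = begin
    length u                                           ≡⟨ cong length u≡xA′B′y ⟩
    length ((x ++ A′) ++ (B′ ++ y))                    ≡⟨ length-++ (x ++ A′) ⟩
    length (x ++ A′) + length (B′ ++ y)                ≡⟨ cong₂ _+_ (length-++ x) (length-++ B′) ⟩
    (length x + length A′) + (length B′ + length y)    ≡⟨ regroup (length x) (length y) (proj₂ (All.lookup lp instr)) ⟩
    (length x + length A) + (length B + length y)      ≡⟨ cong₂ _+_ (sym (length-++ x)) (sym (length-++ B)) ⟩
    length (x ++ A) + length (B ++ y)                  ≡⟨ cong₂ _+_ (cong length (sym w≡xA)) (cong length (sym z≡By)) ⟩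
    length w + length z                                ∎
    where
    open ≡-Reasoning
    regroup : ∀ {a b a′ b′} k l → a + b ≡ a′ + b′ → (k + a′) + (b′ + l) ≡ (k + a) + (b + l)
    regroup {a} {b} {a′} {b′} k l a+b≡a′+b′ = begin
      (k + a′) + (b′ + l) ≡⟨ +-assoc k a′ (b′ + l) ⟩
      k + (a′ + (b′ + l)) ≡⟨ cong (k +_) (sym (+-assoc a′ b′ l)) ⟩
      k + ((a′ + b′) + l) ≡⟨ cong (λ m → k + (m + l)) (sym a+b≡a′+b′) ⟩
      k + ((a + b) + l)   ≡⟨ cong (k +_) (+-assoc a b l) ⟩
      k + (a + (b + l))   ≡⟨ sym (+-assoc k a (b + l)) ⟩
      (k + a) + (b + l)   ∎

  Fires-offset : s ≤ length u
  Fires-offset = begin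
    s                                           ≡⟨ s≡∣xA′∣ ⟩
    length (x ++ A′)                            ≤⟨ m≤m+n _ _ ⟩
    length (x ++ A′) + length (B′ ++ y)         ≡⟨ sym (length-++ (x ++ A′)) ⟩
    length ((x ++ A′) ++ (B′ ++ y))             ≡⟨ cong length (sym u≡xA′B′y) ⟩
    length u                                    ∎
    where open ≤-Reasoning

  Fires-target : q ∈ statesOf S
  Fires-target = target∈statesOf instr

  Fires-step : ∀ C D → Step S ⟨ C ++ w , p , z ++ D ⟩ ⟨ C ++ x ++ A′ , q , (B′ ++ y) ++ D ⟩
  Fires-step C D = subst₂ (Step S)
    (cong₂ (λ L R → ⟨ L , p , R ⟩) (trans (++-assoc C x A) (cong (C ++_) (sym w≡xA)))
                                    (trans (sym (++-assoc B y D)) (cong (_++ D) (sym z≡By))))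
    (cong₂ (λ L R → ⟨ L , q , R ⟩) (++-assoc C x A′) (sym (++-assoc B′ y D)))
    (step (C ++ x) (y ++ D) instr)

-- The simulator

-- Counters count the cells still to traverse; `scan` accumulates the symbols read, last first;
-- `write` holds the symbols still to write and the distance to move back afterwards.
data Ctrl : Set where
  seek  : State → ℕ → Ctrl
  scan  : State → ℕ → Word → Ctrl
  write : State → Word → ℕ → Ctrl
  back  : State → ℕ → Ctrl

fields : Ctrl → ℕ × State × ℕ × Word
fields (seek p i)     = 0 , p , i , []
fields (scan p i v)   = 1 , p , i , v
fields (write q ws s) = 2 , q , s , ws
fields (back q j)     = 3 , q , j , []

fromFields : ℕ × State × ℕ × Word → Ctrl
fromFields (0 , p , i , _)  = seek p i
fromFields (1 , p , i , v)  = scan p i v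
fromFields (2 , q , s , ws) = write q ws s
fromFields (_ , q , j , _)  = back q j

fromFields∘fields : ∀ c → fromFields (fields c) ≡ c
fromFields∘fields (seek _ _)    = refl
fromFields∘fields (scan _ _ _)  = refl
fromFields∘fields (write _ _ _) = refl
fromFields∘fields (back _ _)    = refl

_≟ᶜ_ : DecidableEquality Ctrl
c ≟ᶜ c′ = map′ fields-injective (cong fields) (fields c ≟ᶠ fields c′)
  where
  _≟ᶠ_ : DecidableEquality (ℕ × State × ℕ × Word)
  _≟ᶠ_ = Product.≡-dec ℕ._≟_ (Product.≡-dec ℕ._≟_ (Product.≡-dec ℕ._≟_ (List.≡-dec Bool._≟_)))
  fields-injective : fields c ≡ fields c′ → c ≡ c′
  fields-injective eq = trans (sym (fromFields∘fields c)) (trans (cong fromFields eq) (fromFields∘fields c′))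

-- `left` is the left stack reversed, so the symbol adjacent to the head comes first.
record Tape : Set where
  constructor tape
  field
    left  : Word
    ctrl  : Ctrl
    right : Word
open Tape public

data Heading : Set where
  leftward rightward : Heading

heading : Ctrl → Heading
heading (seek _ _)    = leftward
heading (scan _ _ _)  = rightward
heading (write _ _ _) = leftward
heading (back _ _)    = rightward

module Simulator (S : Machine) where

  size : Instr → ℕ
  size (l ⇒ _) = lenL l + lenR l

  maxSize : ℕ
  maxSize = max 0 (map size S)

  radius : ℕ
  radius = suc maxSize

  width : ℕ
  width = radius + radius

  seek′ : State → ℕ → Ctrl
  seek′ p zero    = scan p width []
  seek′ p (suc i) = seek p (suc i)

  back′ : State → ℕ → Ctrl
  back′ q zero    = seek q radius
  back′ q (suc j) = back q (suc j)

  write′ : State → Word → ℕ → Ctrl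
  write′ q []       s = back′ q s
  write′ q (b ∷ ws) s = write q (b ∷ ws) s

  startWrite : Word × ℕ × State → Ctrl
  startWrite (u , s , q) = write′ q (reverse u) s

  afterScan : State → Word → Maybe Ctrl
  afterScan p v = Maybe.map startWrite (fire S p (take radius (reverse v)) (drop radius (reverse v)))

  scan′ : State → ℕ → Word → Maybe Ctrl
  scan′ p zero    v = afterScan p v
  scan′ p (suc i) v = just (scan p (suc i) v)

  transition : Ctrl → Bool → Maybe (Bool × Ctrl)
  transition (seek p (suc i))     a = just (a , seek′ p i)
  transition (scan p (suc i) v)   a = Maybe.map (a ,_) (scan′ p i (a ∷ v))
  transition (write q (b ∷ ws) s) a = just (b , write′ q ws s)
  transition (back q (suc j))     a = just (a , back′ q j)
  transition _                    _ = nothing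

  pushRight : Word → Word → Bool × Ctrl → Tape
  pushRight L R (b , c) = tape L c (b ∷ R)

  pushLeft : Word → Word → Bool × Ctrl → Tape
  pushLeft L R (b , c) = tape (b ∷ L) c R

  move : Heading → Ctrl → Word → Word → Maybe Tape
  move leftward  c []      R       = nothing
  move leftward  c (a ∷ L) R       = Maybe.map (pushRight L R) (transition c a)
  move rightward c L       []      = nothing
  move rightward c L       (a ∷ R) = Maybe.map (pushLeft L R) (transition c a)

  next : Tape → Maybe Tape
  next (tape L c R) = move (heading c) c L R

  run : ℕ → Tape → Maybe Tape
  run zero    T = just T
  run (suc n) T = next T >>= run n

  infix 4 _↦_
  data _↦_ : Tape → Tape → Set where
    ↦leftward  : ∀ {L c R a b c′} → heading c ≡ leftward → transition c a ≡ just (b , c′) →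
                 tape (a ∷ L) c R ↦ tape L c′ (b ∷ R)
    ↦rightward : ∀ {L c R a b c′} → heading c ≡ rightward → transition c a ≡ just (b , c′) →
                 tape L c (a ∷ R) ↦ tape (b ∷ L) c′ R

  next-complete : ∀ {T T′} → T ↦ T′ → next T ≡ just T′
  next-complete (↦leftward  h≡ δ≡) rewrite h≡ | δ≡ = refl
  next-complete (↦rightward h≡ δ≡) rewrite h≡ | δ≡ = refl

  next-sound : ∀ T {T′} → next T ≡ just T′ → T ↦ T′
  next-sound (tape L c R) eq with heading c in h≡ | L | R
  ... | leftward  | a ∷ L′ | _ with transition c a in δ≡
  ...   | just _ with refl ← eq = ↦leftward h≡ δ≡
  next-sound (tape L c R) eq | rightward | _ | a ∷ R′ with transition c a in δ≡
  ...   | just _ with refl ← eq = ↦rightward h≡ δ≡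

  scanWriteAt : State → ℕ → Word → List Ctrl
  scanWriteAt p i w = scan p i w ∷ write p w i ∷ []

  controlsAt : State → ℕ → List Ctrl
  controlsAt p i = seek p i ∷ back p i ∷ concatMap (scanWriteAt p i) (wordsUpTo width)

  controlsFor : State → List Ctrl
  controlsFor p = concatMap (controlsAt p) (upTo (suc width))

  controls : List Ctrl
  controls = concatMap controlsFor (statesOf S)

  ∈-controls : ∀ {p i c} → p ∈ statesOf S → i ≤ width → c ∈ controlsAt p i → c ∈ controls
  ∈-controls {p} p∈ i≤ c∈ =
    ∈-concatMap⁺′ {f = controlsFor} p∈ (∈-concatMap⁺′ {f = controlsAt p} (∈-upTo⁺ (s≤s i≤)) c∈)

  -- Injective on `controls` only: all other controls get the code `length controls`.
  code : Ctrl → State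
  code c = position _≟ᶜ_ c controls

  instruction : Heading → Ctrl → Bool → Bool × Ctrl → Instr
  instruction leftward  c a (b , c′) = ⟨ a ∷ [] , code c , [] ⟩ ⇒ ⟨ [] , code c′ , b ∷ [] ⟩
  instruction rightward c a (b , c′) = ⟨ [] , code c , a ∷ [] ⟩ ⇒ ⟨ b ∷ [] , code c′ , [] ⟩

  instructionsAt : Ctrl → Bool → List Instr
  instructionsAt c a = maybe′ (λ r → instruction (heading c) c a r ∷ []) [] (transition c a)

  compiled : Machine
  compiled = concatMap (λ c → instructionsAt c false ++ instructionsAt c true) controls

  instruction-simple : ∀ h c a r → SimpleInstr (instruction h c a r)
  instruction-simple leftward  c a (b , c′) = refl , refl , refl , refl
  instruction-simple rightward c a (b , c′) = refl , refl , refl , refl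

  compiled-simple : Simple compiled
  compiled-simple = All.concat⁺ (All.map⁺ (All.universal simpleAt controls))
    where
    simpleAtFor : ∀ c a → Simple (instructionsAt c a)
    simpleAtFor c a with transition c a
    ... | nothing = []
    ... | just r  = instruction-simple (heading c) c a r ∷ []
    simpleAt : ∀ c → Simple (instructionsAt c false ++ instructionsAt c true)
    simpleAt c = All.++⁺ (simpleAtFor c false) (simpleAtFor c true)

  ∈-instructionsAt⁺ : ∀ {c a r} → transition c a ≡ just r → instruction (heading c) c a r ∈ instructionsAt c a
  ∈-instructionsAt⁺ δ≡ rewrite δ≡ = here refl

  ∈-instructionsAt⁻ : ∀ {i} c a → i ∈ instructionsAt c a →
                      ∃ λ r → transition c a ≡ just r × i ≡ instruction (heading c) c a r
  ∈-instructionsAt⁻ c a i∈ with transition c a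
  ∈-instructionsAt⁻ c a (here refl) | just r = r , refl , refl

  ∈-compiled⁺ : ∀ {c a r} → c ∈ controls → transition c a ≡ just r → instruction (heading c) c a r ∈ compiled
  ∈-compiled⁺ {c} {false} c∈ δ≡ = ∈-concatMap⁺′ c∈ (∈-++⁺ˡ (∈-instructionsAt⁺ δ≡))
  ∈-compiled⁺ {c} {true}  c∈ δ≡ = ∈-concatMap⁺′ c∈ (∈-++⁺ʳ (instructionsAt c false) (∈-instructionsAt⁺ δ≡))

  ∈-compiled⁻ : ∀ {i} → i ∈ compiled →
                ∃₂ λ c a → c ∈ controls × ∃ λ r → transition c a ≡ just r × i ≡ instruction (heading c) c a r
  ∈-compiled⁻ i∈ with find (∈-concatMap⁻ _ i∈)
  ... | c , c∈ , i∈c with ∈-++⁻ (instructionsAt c false) i∈c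
  ...   | inj₁ i∈cf = c , false , c∈ , ∈-instructionsAt⁻ c false i∈cf
  ...   | inj₂ i∈ct = c , true  , c∈ , ∈-instructionsAt⁻ c true i∈ct

  toConfig : Tape → Config
  toConfig (tape L c R) = ⟨ reverse L , code c , R ⟩

  embed : Config → Tape
  embed ⟨ L , p , R ⟩ = tape (reverse L) (seek p radius) R

  compiled-step⁺ : ∀ {T T′} → ctrl T ∈ controls → T ↦ T′ → Step compiled (toConfig T) (toConfig T′)
  compiled-step⁺ {tape (a ∷ L) c R} c∈ (↦leftward h≡ δ≡) =
    subst₂ (Step compiled)
      (cong (λ X → ⟨ X , code c , R ⟩) (sym (unfold-reverse a L)))
      (cong (λ X → ⟨ X , _ , _ ⟩) (++-identityʳ (reverse L)))
      (step (reverse L) R (subst (λ h → instruction h c a _ ∈ compiled) h≡ (∈-compiled⁺ c∈ δ≡)))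
  compiled-step⁺ {tape L c (a ∷ R)} c∈ (↦rightward {b = b} h≡ δ≡) =
    subst₂ (Step compiled)
      (cong (λ X → ⟨ X , code c , a ∷ R ⟩) (++-identityʳ (reverse L)))
      (cong (λ X → ⟨ X , _ , R ⟩) (sym (unfold-reverse b L)))
      (step (reverse L) R (subst (λ h → instruction h c a _ ∈ compiled) h≡ (∈-compiled⁺ c∈ δ≡)))

  compiled-step⁻ : ∀ {X Y} → Step compiled X Y →
                   ∃₂ λ T T′ → X ≡ toConfig T × Y ≡ toConfig T′ × ctrl T ∈ controls × T ↦ T′
  compiled-step⁻ (step C D i∈) with ∈-compiled⁻ i∈
  ... | c , a , c∈ , (b , c′) , δ≡ , i≡ with heading c in h≡
  ...   | leftward with refl ← i≡ =
    tape (a ∷ reverse C) c D , tape (reverse C) c′ (b ∷ D) ,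
    cong (λ X → ⟨ X , code c , D ⟩) (sym (reverse-∷-reverse a C)) ,
    cong (λ X → ⟨ X , code c′ , b ∷ D ⟩) (trans (++-identityʳ C) (sym (reverse-involutive C))) ,
    c∈ , ↦leftward h≡ δ≡
  ...   | rightward with refl ← i≡ =
    tape (reverse C) c (a ∷ D) , tape (b ∷ reverse C) c′ D ,
    cong (λ X → ⟨ X , code c , a ∷ D ⟩) (trans (++-identityʳ C) (sym (reverse-involutive C))) ,
    cong (λ X → ⟨ X , code c′ , D ⟩) (sym (reverse-∷-reverse b C)) ,
    c∈ , ↦rightward h≡ δ≡

  toConfig-injective : ∀ {T T′} → ctrl T′ ∈ controls → toConfig T ≡ toConfig T′ → T ≡ T′
  toConfig-injective {tape L c R} {tape L′ c′ R′} c′∈ eq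
    with refl ← reverse-injective {x = L} {y = L′} (cong Config.left eq)
       | refl ← position-injective _≟ᶜ_ c′∈ (cong Config.state eq)
       | refl ← cong Config.right eq = refl

  compiled-deterministic : Deterministic compiled
  compiled-deterministic X⟶Y X⟶Y′ with compiled-step⁻ X⟶Y | compiled-step⁻ X⟶Y′
  ... | T₁ , T₁′ , refl , refl , _ , T₁↦T₁′ | T₂ , T₂′ , T₁≡T₂ , refl , c₂∈ , T₂↦T₂′
    with refl ← toConfig-injective {T₁} {T₂} c₂∈ T₁≡T₂ =
    cong toConfig (just-injective (trans (sym (next-complete T₁↦T₁′)) (next-complete T₂↦T₂′)))

module Runs (S : Machine) where
  open Simulator S

  run-+ : ∀ m {n} T {T′} → run m T ≡ just T′ → run (m + n) T ≡ run n T′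
  run-+ zero    T refl = refl
  run-+ (suc m) T eq with next T
  ... | just T₁ = run-+ m T₁ eq

  run-stuck-+ : ∀ m n T → run m T ≡ nothing → run (m + n) T ≡ nothing
  run-stuck-+ (suc m) n T eq with next T
  ... | just T₁ = run-stuck-+ m n T₁ eq
  ... | nothing = refl

  run-stuck-≤ : ∀ {m n} T → m ≤ n → run m T ≡ nothing → run n T ≡ nothing
  run-stuck-≤ {m} {n} T m≤n eq = subst (λ k → run k T ≡ nothing) (m+[n∸m]≡n m≤n) (run-stuck-+ m (n ∸ m) T eq)

  seek-run : ∀ p (w L R : Word) →
             run (length w) (tape (w ++ L) (seek′ p (length w)) R) ≡ just (tape L (scan p width []) (w ʳ++ R))
  seek-run p []      L R = refl
  seek-run p (a ∷ w) L R = seek-run p w L (a ∷ R)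

  seek-stuck : ∀ p i L R → length L < i → run i (tape L (seek′ p i) R) ≡ nothing
  seek-stuck p (suc i)       []      R _               = refl
  seek-stuck p (suc (suc i)) (a ∷ L) R (s≤s ∣L∣<1+i) = seek-stuck p (suc i) L (a ∷ R) ∣L∣<1+i

  scan-run : ∀ p i v (z L R : Word) → length z ≡ suc i →
             run (suc i) (tape L (scan p (suc i) v) (z ++ R)) ≡
             Maybe.map (λ c → tape (z ʳ++ L) c R) (afterScan p (z ʳ++ v))
  scan-run p zero    v (a ∷ []) L R refl with afterScan p (a ∷ v)
  ... | just _  = refl
  ... | nothing = refl
  scan-run p (suc i) v (a ∷ z) L R ∣z∣≡ = scan-run p i (a ∷ v) z (a ∷ L) R (suc-injective ∣z∣≡)

  scan-stuck : ∀ p i v L R → length R < suc i → run (suc i) (tape L (scan p (suc i) v) R) ≡ nothing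
  scan-stuck p i       v L []      _              = refl
  scan-stuck p (suc i) v L (a ∷ R) (s≤s ∣R∣<1+i) = scan-stuck p i (a ∷ v) (a ∷ L) R ∣R∣<1+i

  write-run : ∀ q ws s (Z L R : Word) → length Z ≡ length ws →
              run (length ws) (tape (Z ++ L) (write′ q ws s) R) ≡ just (tape L (back′ q s) (ws ʳ++ R))
  write-run q []       s []      L R _     = refl
  write-run q (b ∷ ws) s (a ∷ Z) L R ∣Z∣≡ = write-run q ws s Z L (b ∷ R) (suc-injective ∣Z∣≡)

  back-run : ∀ q (Z L R : Word) →
             run (length Z) (tape L (back′ q (length Z)) (Z ++ R)) ≡ just (tape (Z ʳ++ L) (seek q radius) R)
  back-run q []      L R = refl
  back-run q (a ∷ Z) L R = back-run q Z (a ∷ L) R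

  seek-embed : ∀ C w p R → length w ≡ radius →
               run radius (embed ⟨ C ++ w , p , R ⟩) ≡ just (tape (reverse C) (scan p width []) (w ++ R))
  seek-embed C w p R ∣w∣≡radius = begin
    run radius (tape (reverse (C ++ w)) (seek p radius) R)
      ≡⟨ cong₂ (λ n L → run n (tape L (seek′ p n) R)) (sym ∣w∣≡radius′) (reverse-++ C w) ⟩
    run (length (reverse w)) (tape (reverse w ++ reverse C) (seek′ p (length (reverse w))) R)
      ≡⟨ seek-run p (reverse w) (reverse C) R ⟩
    just (tape (reverse C) (scan p width []) (reverse w ʳ++ R))
      ≡⟨ cong (λ R′ → just (tape (reverse C) (scan p width []) R′)) (reverse-ʳ++ w R) ⟩
    just (tape (reverse C) (scan p width []) (w ++ R)) ∎
    where
    open ≡-Reasoning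
    ∣w∣≡radius′ : length (reverse w) ≡ radius
    ∣w∣≡radius′ = trans (length-reverse w) ∣w∣≡radius

  afterScan-window : ∀ p w z → length w ≡ radius → afterScan p ((w ++ z) ʳ++ []) ≡ Maybe.map startWrite (fire S p w z)
  afterScan-window p w z ∣w∣≡radius = cong₂ (λ w′ z′ → Maybe.map startWrite (fire S p w′ z′))
    (trans (cong (take radius) scanned) (subst (λ n → take n (w ++ z) ≡ w) ∣w∣≡radius (take-++-length w z)))
    (trans (cong (drop radius) scanned) (subst (λ n → drop n (w ++ z) ≡ z) ∣w∣≡radius (drop-++-length w z)))
    where
    scanned : reverse ((w ++ z) ʳ++ []) ≡ w ++ z
    scanned = trans (cong reverse (trans (ʳ++-defn (w ++ z)) (++-identityʳ _))) (reverse-involutive (w ++ z))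

  scan-window : ∀ p w z L D → length w ≡ radius → length z ≡ radius →
                run width (tape L (scan p width []) (w ++ z ++ D)) ≡
                Maybe.map (λ c → tape ((w ++ z) ʳ++ L) c D) (Maybe.map startWrite (fire S p w z))
  scan-window p w z L D ∣w∣≡radius ∣z∣≡radius = begin
    run width (tape L (scan p width []) (w ++ z ++ D))
      ≡⟨ cong (λ R → run width (tape L (scan p width []) R)) (sym (++-assoc w z D)) ⟩
    run width (tape L (scan p width []) ((w ++ z) ++ D))
      ≡⟨ scan-run p (maxSize + radius) [] (w ++ z) L D (trans (length-++ w) (cong₂ _+_ ∣w∣≡radius ∣z∣≡radius)) ⟩
    Maybe.map (λ c → tape ((w ++ z) ʳ++ L) c D) (afterScan p ((w ++ z) ʳ++ []))
      ≡⟨ cong (Maybe.map (λ c → tape ((w ++ z) ʳ++ L) c D)) (afterScan-window p w z ∣w∣≡radius) ⟩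
    Maybe.map (λ c → tape ((w ++ z) ʳ++ L) c D) (Maybe.map startWrite (fire S p w z)) ∎
    where open ≡-Reasoning

  read-window : ∀ C w z D p → length w ≡ radius → length z ≡ radius →
                run (radius + width) (embed ⟨ C ++ w , p , z ++ D ⟩) ≡
                Maybe.map (λ c → tape ((w ++ z) ʳ++ reverse C) c D) (Maybe.map startWrite (fire S p w z))
  read-window C w z D p ∣w∣≡radius ∣z∣≡radius = begin
    run (radius + width) (embed ⟨ C ++ w , p , z ++ D ⟩)
      ≡⟨ run-+ radius (embed ⟨ C ++ w , p , z ++ D ⟩) (seek-embed C w p (z ++ D) ∣w∣≡radius) ⟩
    run width (tape (reverse C) (scan p width []) (w ++ z ++ D))
      ≡⟨ scan-window p w z (reverse C) D ∣w∣≡radius ∣z∣≡radius ⟩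
    Maybe.map (λ c → tape ((w ++ z) ʳ++ reverse C) c D) (Maybe.map startWrite (fire S p w z)) ∎
    where open ≡-Reasoning

  write-back : ∀ q {u s} (x y Z C D : Word) → u ≡ x ++ y → s ≡ length x → length Z ≡ length u →
               run (length u + s) (tape (Z ʳ++ reverse C) (write′ q (reverse u) s) D) ≡ just (embed ⟨ C ++ x , q , y ++ D ⟩)
  write-back q x y Z C D refl refl ∣Z∣≡∣xy∣ = begin
    run (length (x ++ y) + length x) (tape (Z ʳ++ reverse C) (write′ q (reverse (x ++ y)) (length x)) D)
      ≡⟨ run-+ (length (x ++ y)) (tape (Z ʳ++ reverse C) (write′ q (reverse (x ++ y)) (length x)) D) written ⟩
    run (length x) (tape (reverse C) (back′ q (length x)) (x ++ y ++ D))
      ≡⟨ back-run q x (reverse C) (y ++ D) ⟩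
    just (tape (x ʳ++ reverse C) (seek q radius) (y ++ D))
      ≡⟨ cong (λ L → just (tape L (seek q radius) (y ++ D))) (trans (ʳ++-defn x) (sym (reverse-++ C x))) ⟩
    just (embed ⟨ C ++ x , q , y ++ D ⟩) ∎
    where
    open ≡-Reasoning
    xy = x ++ y
    written : run (length xy) (tape (Z ʳ++ reverse C) (write′ q (reverse xy) (length x)) D) ≡
              just (tape (reverse C) (back′ q (length x)) (x ++ y ++ D))
    written = begin
      run (length xy) (tape (Z ʳ++ reverse C) (write′ q (reverse xy) (length x)) D)
        ≡⟨ cong₂ (λ n L → run n (tape L (write′ q (reverse xy) (length x)) D)) (sym (length-reverse xy)) (ʳ++-defn Z) ⟩
      run (length (reverse xy)) (tape (reverse Z ++ reverse C) (write′ q (reverse xy) (length x)) D)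
        ≡⟨ write-run q (reverse xy) (length x) (reverse Z) (reverse C) D
                     (trans (length-reverse Z) (trans ∣Z∣≡∣xy∣ (sym (length-reverse xy)))) ⟩
      just (tape (reverse C) (back′ q (length x)) (reverse xy ʳ++ D))
        ≡⟨ cong (λ R → just (tape (reverse C) (back′ q (length x)) R)) (trans (reverse-ʳ++ xy D) (++-assoc x y D)) ⟩
      just (tape (reverse C) (back′ q (length x)) (x ++ y ++ D)) ∎

  instr-fits : ∀ {A p B A′ q B′} → (⟨ A , p , B ⟩ ⇒ ⟨ A′ , q , B′ ⟩) ∈ S →
               length A ≤ radius × length B ≤ radius
  instr-fits i∈S = ≤-trans (m≤m+n _ _) size≤radius , ≤-trans (m≤n+m _ _) size≤radius
    where size≤radius = ≤-trans (f≤max-map size i∈S) (n≤1+n maxSize)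

  -- seek, scan, write, and a move back of at most `width` cells
  period : ℕ
  period = (radius + width) + (width + width)

  stuck-left : ∀ L p R → length L < radius → run period (embed ⟨ L , p , R ⟩) ≡ nothing
  stuck-left L p R ∣L∣<radius = run-stuck-≤ (embed ⟨ L , p , R ⟩) (≤-trans (m≤m+n radius width) (m≤m+n _ _))
    (seek-stuck p radius (reverse L) R (subst (_< radius) (sym (length-reverse L)) ∣L∣<radius))

  stuck-right : ∀ C w p R → length w ≡ radius → length R < radius → run period (embed ⟨ C ++ w , p , R ⟩) ≡ nothing
  stuck-right C w p R ∣w∣≡radius ∣R∣<radius = run-stuck-≤ (embed ⟨ C ++ w , p , R ⟩) (m≤m+n (radius + width) _)
    (trans (run-+ radius (embed ⟨ C ++ w , p , R ⟩) (seek-embed C w p R ∣w∣≡radius))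
           (scan-stuck p (maxSize + radius) [] (reverse C) (w ++ R) ∣wR∣<width))
    where
    ∣wR∣<width : length (w ++ R) < width
    ∣wR∣<width = subst (_< width) (sym (trans (length-++ w) (cong (_+ length R) ∣w∣≡radius))) (+-monoʳ-< radius ∣R∣<radius)

  stuck-unfired : ∀ C w z D p → length w ≡ radius → length z ≡ radius → fire S p w z ≡ nothing →
                  run period (embed ⟨ C ++ w , p , z ++ D ⟩) ≡ nothing
  stuck-unfired C w z D p ∣w∣≡radius ∣z∣≡radius unfired =
    run-stuck-≤ (embed ⟨ C ++ w , p , z ++ D ⟩) (m≤m+n (radius + width) _)
    (trans (read-window C w z D p ∣w∣≡radius ∣z∣≡radius)
           (cong (Maybe.map (λ c → tape ((w ++ z) ʳ++ reverse C) c D) ∘ Maybe.map startWrite) unfired))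

  record Cycle (X : Config) : Set where
    field
      duration        : ℕ
      successor       : Config
      0<duration    : 0 < duration
      duration≤period : duration ≤ period
      runs-to         : run duration (embed X) ≡ just (embed successor)
      steps-to        : Step S X successor

  module _ (lp : LengthPreserving S) where

    afterScan-sound : ∀ {p v c} → afterScan p v ≡ just c →
                      ∃₂ λ q u → ∃ λ s → c ≡ write′ q (reverse u) s ×
                                          q ∈ statesOf S × length u ≡ length v × s ≤ length u
    afterScan-sound {p} {v} eq with fire S p (take radius (reverse v)) (drop radius (reverse v)) in fired
    afterScan-sound {p} {v} refl | just (u , s , q) =
      q , u , s , refl , Fires-target fires , trans (Fires-length fires lp) ∣window∣≡∣v∣ , Fires-offset fires
      where
      fires = fire-sound S fired
      ∣window∣≡∣v∣ : length (take radius (reverse v)) + length (drop radius (reverse v)) ≡ length v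
      ∣window∣≡∣v∣ = begin
        length (take radius (reverse v)) + length (drop radius (reverse v)) ≡⟨ length-++ (take radius (reverse v)) ⟨
        length (take radius (reverse v) ++ drop radius (reverse v))         ≡⟨ cong length (take++drop≡id radius (reverse v)) ⟩
        length (reverse v)                                                  ≡⟨ length-reverse v ⟩
        length v                                                            ∎
        where open ≡-Reasoning

    cycle-fires : ∀ C {w z} D {p u s q} → length w ≡ radius → length z ≡ radius →
                  fire S p w z ≡ just (u , s , q) → Cycle ⟨ C ++ w , p , z ++ D ⟩
    cycle-fires C {w} {z} D {p} {u} {s} {q} ∣w∣≡radius ∣z∣≡radius fired = record
      { duration        = (radius + width) + (length u + s)
      ; successor       = ⟨ C ++ x ++ A′ , q , (B′ ++ y) ++ D ⟩
      ; 0<duration    = s≤s z≤n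
      ; duration≤period = +-monoʳ-≤ (radius + width)
                            (+-mono-≤ (≤-reflexive ∣u∣≡width) (≤-trans (Fires-offset fires) (≤-reflexive ∣u∣≡width)))
      ; runs-to         = trans (run-+ (radius + width) (embed ⟨ C ++ w , p , z ++ D ⟩) read)
                                (write-back q (x ++ A′) (B′ ++ y) (w ++ z) C D u≡xA′B′y s≡∣xA′∣ ∣wz∣≡∣u∣)
      ; steps-to        = Fires-step fires C D
      }
      where
      fires = fire-sound S fired
      open Fires fires
      ∣wz∣≡∣u∣ : length (w ++ z) ≡ length u
      ∣wz∣≡∣u∣ = trans (length-++ w) (sym (Fires-length fires lp))
      ∣u∣≡width : length u ≡ width
      ∣u∣≡width = trans (Fires-length fires lp) (cong₂ _+_ ∣w∣≡radius ∣z∣≡radius)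
      read : run (radius + width) (embed ⟨ C ++ w , p , z ++ D ⟩) ≡
             just (tape ((w ++ z) ʳ++ reverse C) (write′ q (reverse u) s) D)
      read = trans (read-window C w z D p ∣w∣≡radius ∣z∣≡radius)
                   (cong (Maybe.map (λ c → tape ((w ++ z) ʳ++ reverse C) c D) ∘ Maybe.map startWrite) fired)

    cycle-or-stuck : ∀ X → Cycle X ⊎ run period (embed X) ≡ nothing
    cycle-or-stuck ⟨ L , p , R ⟩ with radius ≤? length L
    ... | no radius≰∣L∣ = inj₂ (stuck-left L p R (≰⇒> radius≰∣L∣))
    ... | yes radius≤∣L∣ with C , w , refl , ∣w∣≡radius ← splitAtEnd radius L radius≤∣L∣ with radius ≤? length R
    ...   | no radius≰∣R∣ = inj₂ (stuck-right C w p R ∣w∣≡radius (≰⇒> radius≰∣R∣))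
    ...   | yes radius≤∣R∣ with z , D , refl , ∣z∣≡radius ← splitAtStart radius R radius≤∣R∣ with fire S p w z in fired
    ...     | just _  = inj₁ (cycle-fires C D ∣w∣≡radius ∣z∣≡radius fired)
    ...     | nothing = inj₂ (stuck-unfired C w z D p ∣w∣≡radius ∣z∣≡radius fired)

    step⇒run : Deterministic S → ∀ {L p R Y} → radius ≤ length L → radius ≤ length R →
               Step S ⟨ L , p , R ⟩ Y → ∃ λ t → run t (embed ⟨ L , p , R ⟩) ≡ just (embed Y)
    step⇒run det {p = p} radius≤∣L∣ radius≤∣R∣ X⟶Y@(step {A} {B = B} C₀ D₀ i∈S)
      with C , w , C₀A≡Cw , ∣w∣≡radius ← splitAtEnd radius _ radius≤∣L∣
         | z , D , BD₀≡zD , ∣z∣≡radius ← splitAtStart radius _ radius≤∣R∣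
      with x , w≡xA ← ++-suffix C w C₀ A (sym C₀A≡Cw) (subst (length A ≤_) (sym ∣w∣≡radius) (proj₁ (instr-fits i∈S)))
         | y , z≡By ← ++-prefix z D B D₀ (sym BD₀≡zD) (subst (length B ≤_) (sym ∣z∣≡radius) (proj₂ (instr-fits i∈S)))
      with _ , fired ← fire-complete S i∈S w≡xA z≡By
      = duration , subst (λ Y → run duration (embed ⟨ C₀ ++ A , p , B ++ D₀ ⟩) ≡ just (embed Y)) (det steps-to X⟶Y) runs-to
      where
      open Cycle (subst Cycle (sym (cong₂ (λ L R → ⟨ L , p , R ⟩) C₀A≡Cw BD₀≡zD))
                                   (cycle-fires C D ∣w∣≡radius ∣z∣≡radius fired))

-- Boundedness of the simulator implies boundedness of S

module Reflection (S : Machine) (lp : LengthPreserving S) where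
  open Simulator S
  open Runs S

  WellFormed : Ctrl → Set
  WellFormed (seek p i)     = p ∈ statesOf S × i ≤ width
  WellFormed (scan p i v)   = p ∈ statesOf S × i + length v ≤ width
  WellFormed (write q ws s) = q ∈ statesOf S × length ws ≤ width × s ≤ width
  WellFormed (back q j)     = q ∈ statesOf S × j ≤ width

  wellFormed⇒∈controls : ∀ c → WellFormed c → c ∈ controls
  wellFormed⇒∈controls (seek p i)     (p∈ , i≤)           = ∈-controls p∈ i≤ (here refl)
  wellFormed⇒∈controls (back q j)     (q∈ , j≤)           = ∈-controls q∈ j≤ (there (here refl))
  wellFormed⇒∈controls (scan p i v)   (p∈ , i+∣v∣≤)       =
    ∈-controls p∈ (≤-trans (m≤m+n i _) i+∣v∣≤)
      (there (there (∈-concatMap⁺′ {f = scanWriteAt p i} (∈-wordsUpTo v (≤-trans (m≤n+m _ i) i+∣v∣≤)) (here refl))))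
  wellFormed⇒∈controls (write q ws s) (q∈ , ∣ws∣≤ , s≤)   =
    ∈-controls q∈ s≤ (there (there (∈-concatMap⁺′ {f = scanWriteAt q s} (∈-wordsUpTo ws ∣ws∣≤) (there (here refl)))))

  back′-wellFormed : ∀ q j → q ∈ statesOf S → j ≤ width → WellFormed (back′ q j)
  back′-wellFormed q zero    q∈ _  = q∈ , m≤m+n radius radius
  back′-wellFormed q (suc j) q∈ j≤ = q∈ , j≤

  write′-wellFormed : ∀ q ws s → q ∈ statesOf S → length ws ≤ width → s ≤ width → WellFormed (write′ q ws s)
  write′-wellFormed q []       s q∈ _     s≤ = back′-wellFormed q s q∈ s≤
  write′-wellFormed q (b ∷ ws) s q∈ ∣ws∣≤ s≤ = q∈ , ∣ws∣≤ , s≤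

  transition-wellFormed : ∀ {c a b c′} → WellFormed c → transition c a ≡ just (b , c′) → WellFormed c′
  transition-wellFormed {seek p (suc zero)}    (p∈ , _)  refl = p∈ , ≤-reflexive (+-identityʳ width)
  transition-wellFormed {seek p (suc (suc i))} (p∈ , i≤) refl = p∈ , ≤-trans (n≤1+n _) i≤
  transition-wellFormed {scan p (suc (suc i)) v} (p∈ , i+∣v∣≤) refl =
    p∈ , subst (_≤ width) (sym (+-suc (suc i) (length v))) i+∣v∣≤
  transition-wellFormed {scan p (suc zero) v} {a} (p∈ , 1+∣v∣≤) δ≡ with afterScan p (a ∷ v) in scanned
  transition-wellFormed {scan p (suc zero) v} {a} (p∈ , 1+∣v∣≤) refl | just _
    with q , u , s , refl , q∈ , ∣u∣≡ , s≤∣u∣ ← afterScan-sound lp {p} {a ∷ v} scanned =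
    write′-wellFormed q (reverse u) s q∈ (≤-trans (≤-reflexive (trans (length-reverse u) ∣u∣≡)) 1+∣v∣≤)
                                        (≤-trans s≤∣u∣ (≤-trans (≤-reflexive ∣u∣≡) 1+∣v∣≤))
  transition-wellFormed {write q (_ ∷ ws) s} (q∈ , ∣ws∣≤ , s≤) refl =
    write′-wellFormed q ws s q∈ (≤-trans (n≤1+n _) ∣ws∣≤) s≤
  transition-wellFormed {back q (suc j)} (q∈ , j≤) refl = back′-wellFormed q j q∈ (≤-trans (n≤1+n _) j≤)

  ↦-wellFormed : ∀ {T T′} → WellFormed (ctrl T) → T ↦ T′ → WellFormed (ctrl T′)
  ↦-wellFormed wf (↦leftward  _ δ≡) = transition-wellFormed wf δ≡
  ↦-wellFormed wf (↦rightward _ δ≡) = transition-wellFormed wf δ≡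

  run⇒steps : ∀ t {T T′} → WellFormed (ctrl T) → run t T ≡ just T′ → Steps (compiled) (toConfig T) (toConfig T′)
  run⇒steps zero    _  refl = ε
  run⇒steps (suc t) {T} wf eq with next T in moved
  ... | just T₁ = compiled-step⁺ (wellFormed⇒∈controls _ wf) T↦T₁ ◅ run⇒steps t (↦-wellFormed wf T↦T₁) eq
    where T↦T₁ = next-sound T moved

  module _ (det : Deterministic S) where

    -- With both stacks padded, every step of S is completed by a cycle of the simulator.
    padding : Word
    padding = replicate radius false

    pad : Config → Config
    pad ⟨ L , p , R ⟩ = ⟨ padding ++ L , p , R ++ padding ⟩

    pad-step : ∀ {X Y} → Step S X Y → Step S (pad X) (pad Y)
    pad-step (step {A} {p} {B} {A′} {q} {B′} C D i∈S) = subst₂ (Step S)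
      (cong₂ (λ L R → ⟨ L , p , R ⟩) (++-assoc padding C A) (sym (++-assoc B D padding)))
      (cong₂ (λ L R → ⟨ L , q , R ⟩) (++-assoc padding C A′) (sym (++-assoc B′ D padding)))
      (step (padding ++ C) (D ++ padding) i∈S)

    radius≤∣padding++∣ : ∀ L → radius ≤ length (padding ++ L)
    radius≤∣padding++∣ L =
      subst (radius ≤_) (sym (trans (length-++ padding) (cong (_+ length L) (length-replicate radius)))) (m≤m+n radius _)

    radius≤∣++padding∣ : ∀ R → radius ≤ length (R ++ padding)
    radius≤∣++padding∣ R =
      subst (radius ≤_) (sym (trans (length-++ R) (cong (length R +_) (length-replicate radius)))) (m≤n+m radius _)

    encode : Config → Config
    encode X = toConfig (embed (pad X))

    step⇒compiled-steps : ∀ {X Y} → Step S X Y → Steps compiled (encode X) (encode Y)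
    step⇒compiled-steps {⟨ L , p , R ⟩} X⟶Y
      with t , ran ← step⇒run lp det (radius≤∣padding++∣ L) (radius≤∣++padding∣ R) (pad-step X⟶Y) =
      run⇒steps t (step-source X⟶Y , m≤m+n radius radius) ran

    steps⇒compiled-steps : ∀ {X Y} → Steps S X Y → Steps compiled (encode X) (encode Y)
    steps⇒compiled-steps ε             = ε
    steps⇒compiled-steps (X⟶Z ◅ Z⟶*Y) = step⇒compiled-steps X⟶Z ◅◅ steps⇒compiled-steps Z⟶*Y

    encode-injective : ∀ {Y Y′} → Config.state Y′ ∈ statesOf S → encode Y ≡ encode Y′ → Y ≡ Y′
    encode-injective {⟨ L , p , R ⟩} {⟨ L′ , p′ , R′ ⟩} p′∈ eq
      with T≡T′ ← toConfig-injective {embed (pad ⟨ L , p , R ⟩)}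
                    (wellFormed⇒∈controls (seek p′ radius) (p′∈ , m≤m+n radius radius)) eq
      with refl ← cong ctrl T≡T′ =
      cong₂ (λ L R → ⟨ L , p , R ⟩)
        (++-cancelˡ padding L L′ (reverse-injective (cong left T≡T′)))
        (++-cancelʳ padding R R′ (cong right T≡T′))

    reachable-state : ∀ {X Y} → Steps S X Y → Y ≡ X ⊎ Config.state Y ∈ statesOf S
    reachable-state ε = inj₁ refl
    reachable-state (X⟶Z ◅ Z⟶*Y) with reachable-state Z⟶*Y
    ... | inj₁ refl = inj₂ (step-target X⟶Z)
    ... | inj₂ Y∈   = inj₂ Y∈

    encode-injective-reachable : ∀ {X Y Y′} → Steps S X Y → Steps S X Y′ → encode Y ≡ encode Y′ → Y ≡ Y′
    encode-injective-reachable X⟶*Y X⟶*Y′ eq with reachable-state X⟶*Y | reachable-state X⟶*Y′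
    ... | _         | inj₂ Y′∈ = encode-injective Y′∈ eq
    ... | inj₂ Y∈   | inj₁ _   = sym (encode-injective Y∈ (sym eq))
    ... | inj₁ refl | inj₁ refl = refl

    compiled-bounded⇒bounded : UniformlyBounded compiled → UniformlyBounded S
    compiled-bounded⇒bounded (n , bounded) =
      n , λ X → AtMost-preimage encode steps⇒compiled-steps encode-injective-reachable (bounded (encode X))

-- Boundedness of S implies boundedness of the simulator

module Preservation (S : Machine) (lp : LengthPreserving S) where
  open Simulator S
  open Runs S

  Orbit : Tape → Tape → Set
  Orbit T W = ∃ λ m → run m T ≡ just W

  run-functional : ∀ m → Functional (λ T W → run m T ≡ just W)
  run-functional m ran ran′ = just-injective (trans (sym ran) ran′)

  orbit-toConfig : ∀ T {Y} → Steps compiled (toConfig T) Y → ∃ λ W → Orbit T W × Y ≡ toConfig W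
  orbit-toConfig T ε = T , (0 , refl) , refl
  orbit-toConfig T (X⟶Z ◅ Z⟶*Y)
    with T₁ , T₂ , T≡T₁ , refl , c₁∈ , T₁↦T₂ ← compiled-step⁻ X⟶Z
    with refl ← toConfig-injective {T} {T₁} c₁∈ T≡T₁
    with W , (m , ran) , refl ← orbit-toConfig T₂ Z⟶*Y
    = W , (suc m , trans (cong (_>>= run m) (next-complete T₁↦T₂)) ran) , refl

  compiled-reachable : ∀ {X Y} → Steps compiled X Y →
                       Y ≡ X ⊎ ∃ λ T → (X ≡ toConfig T × ctrl T ∈ controls) × ∃ λ W → Orbit T W × Y ≡ toConfig W
  compiled-reachable ε = inj₁ refl
  compiled-reachable X⟶*Y@(X⟶Z ◅ _) with T , _ , refl , _ , c∈ , _ ← compiled-step⁻ X⟶Z =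
    inj₂ (T , (refl , c∈) , orbit-toConfig T X⟶*Y)

  orbit-embed : ∀ {m} → Acc _<_ m → ∀ Y₀ {W} → run m (embed Y₀) ≡ just W →
                ∃₂ λ j Y → j < period × Steps S Y₀ Y × run j (embed Y) ≡ just W
  orbit-embed {m} (acc smaller) Y₀ ran with m <? period
  ... | yes m<period = m , Y₀ , m<period , ε , ran
  ... | no m≮period with cycle-or-stuck lp Y₀
  ...   | inj₂ stuck = contradiction (trans (sym ran) (run-stuck-≤ (embed Y₀) (≮⇒≥ m≮period) stuck)) λ ()
  ...   | inj₁ cycle = prepend (orbit-embed (smaller (∸-monoʳ-< {m} 0<duration d≤m)) successor resumed)
    where
    open Cycle cycle
    prepend : ∀ {W} → (∃₂ λ j Y → j < period × Steps S successor Y × run j (embed Y) ≡ just W) →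
              ∃₂ λ j Y → j < period × Steps S Y₀ Y × run j (embed Y) ≡ just W
    prepend (j , Y , j<period , Y₁⟶*Y , ran′) = j , Y , j<period , steps-to ◅ Y₁⟶*Y , ran′
    d≤m : duration ≤ m
    d≤m = ≤-trans duration≤period (≮⇒≥ m≮period)
    resumed : run (m ∸ duration) (embed successor) ≡ just _
    resumed = trans (sym (run-+ duration (embed Y₀) runs-to)) (trans (cong (λ k → run k (embed Y₀)) (m+[n∸m]≡n d≤m)) ran)

  scanRank : ℕ → Word → ℕ
  scanRank i v = i + 2 * (i + length v)

  rank : Ctrl → ℕ
  rank (seek _ i)      = i + scanRank width []
  rank (scan _ i v)    = scanRank i v
  rank (write _ ws s)  = length ws + s
  rank (back _ j)      = j

  CycleStart : Ctrl → Set
  CycleStart c = ∃ λ p → c ≡ seek p radius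

  back′-rank : ∀ q j → CycleStart (back′ q j) ⊎ rank (back′ q j) ≤ j
  back′-rank q zero    = inj₁ (q , refl)
  back′-rank q (suc j) = inj₂ (≤-reflexive refl)

  write′-rank : ∀ q ws s → CycleStart (write′ q ws s) ⊎ rank (write′ q ws s) ≤ length ws + s
  write′-rank q []       s = back′-rank q s
  write′-rank q (b ∷ ws) s = inj₂ (≤-reflexive refl)

  ≤-<-trans⊎ : ∀ {A : Set} {k m n} → A ⊎ k ≤ m → m < n → A ⊎ k < n
  ≤-<-trans⊎ (inj₁ a)   _   = inj₁ a
  ≤-<-trans⊎ (inj₂ k≤m) m<n = inj₂ (≤-<-trans k≤m m<n)

  transition-rank : ∀ {c a b c′} → transition c a ≡ just (b , c′) → CycleStart c′ ⊎ rank c′ < rank c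
  transition-rank {seek p (suc zero)}    refl = inj₂ (n<1+n _)
  transition-rank {seek p (suc (suc i))} refl = inj₂ (n<1+n _)
  transition-rank {scan p (suc (suc i)) v} refl =
    inj₂ (subst (λ k → suc i + 2 * suc k < suc (suc i) + 2 * (suc (suc i) + length v)) (sym (+-suc i (length v))) (n<1+n _))
  transition-rank {scan p (suc zero) v} {a} δ≡ with afterScan p (a ∷ v) in scanned
  transition-rank {scan p (suc zero) v} {a} refl | just _
    with q , u , s , refl , _ , ∣u∣≡ , s≤∣u∣ ← afterScan-sound lp {p} {a ∷ v} scanned =
    ≤-<-trans⊎ (write′-rank q (reverse u) s)
      (s≤s (+-mono-≤ (≤-reflexive (trans (length-reverse u) ∣u∣≡))
                     (≤-trans s≤∣u∣ (≤-reflexive (trans ∣u∣≡ (sym (+-identityʳ _)))))))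
  transition-rank {write q (_ ∷ ws) s} refl = ≤-<-trans⊎ (write′-rank q ws s) (n<1+n _)
  transition-rank {back q (suc j)}     refl = ≤-<-trans⊎ (back′-rank q j) (n<1+n _)

  ↦-rank : ∀ {T T′} → T ↦ T′ → CycleStart (ctrl T′) ⊎ rank (ctrl T′) < rank (ctrl T)
  ↦-rank (↦leftward  {c = c} _ δ≡) = transition-rank {c} δ≡
  ↦-rank (↦rightward {c = c} _ δ≡) = transition-rank {c} δ≡

  settle : ∀ m T {W} → run m T ≡ just W →
           m ≤ rank (ctrl T) ⊎ ∃₂ λ t Z → t ≤ suc (rank (ctrl T)) × CycleStart (ctrl Z) × run t T ≡ just Z × Orbit Z W
  settle zero    T ran = inj₁ z≤n
  settle (suc m) T ran with next T in moved
  ... | just T₁ with ↦-rank (next-sound T moved)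
  ...   | inj₁ start = inj₂ (1 , T₁ , s≤s z≤n , start , cong (_>>= run 0) moved , m , ran)
  ...   | inj₂ rank< with settle m T₁ ran
  ...     | inj₁ m≤rank = inj₁ (≤-trans (s≤s m≤rank) rank<)
  ...     | inj₂ (t , Z , t≤ , start , ran₁ , orbit) =
    inj₂ (suc t , Z , s≤s (≤-trans t≤ rank<) , start , trans (cong (_>>= run t) moved) ran₁ , orbit)

  maxRank : ℕ
  maxRank = max 0 (map rank controls)

  module Bounds (n : ℕ) (bounded : ∀ X → AtMost n (Steps S X)) where

    orbit-embed-bounded : ∀ Y₀ → AtMost (period * n) (Orbit (embed Y₀))
    orbit-embed-bounded Y₀ =
      AtMost-⊆ (λ (m , ran) → let j , Y , j<period , Y₀⟶*Y , ran′ = orbit-embed (<-wellFounded m) Y₀ ran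
                              in j , j<period , Y , Y₀⟶*Y , ran′)
        (AtMost-⋃< period λ j _ → AtMost-image {R = λ Y W → run j (embed Y) ≡ just W} (run-functional j) (bounded Y₀))

    orbit-cycleStart-bounded : ∀ {Z} → CycleStart (ctrl Z) → AtMost (period * n) (Orbit Z)
    orbit-cycleStart-bounded {tape L _ R} (p , refl) =
      subst (λ L′ → AtMost (period * n) (Orbit (tape L′ (seek p radius) R))) (reverse-involutive L)
            (orbit-embed-bounded ⟨ reverse L , p , R ⟩)

    orbit-bound : ℕ
    orbit-bound = suc maxRank * 1 + suc (suc maxRank) * (period * n)

    orbit-bounded : ∀ {T} → ctrl T ∈ controls → AtMost orbit-bound (Orbit T)
    orbit-bounded {T} c∈ =
      AtMost-⊆ early-or-late
        (AtMost-∪ (AtMost-⋃< (suc maxRank) λ m _ → AtMost-one (run-functional m))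
                  (AtMost-⋃< (suc (suc maxRank)) λ t _ →
                     AtMost-⋃unique (λ (ran , _) (ran′ , _) → run-functional t ran ran′)
                                    (λ (_ , start) → orbit-cycleStart-bounded start)))
      where
      rank≤ : rank (ctrl T) ≤ maxRank
      rank≤ = f≤max-map rank c∈
      early-or-late : Orbit T ⊆ ((λ W → ∃ λ m → m < suc maxRank × run m T ≡ just W) ∪
                                 (λ W → ∃ λ t → t < suc (suc maxRank) ×
                                        ∃ λ Z → (run t T ≡ just Z × CycleStart (ctrl Z)) × Orbit Z W))
      early-or-late (m , ran) with settle m T ran
      ... | inj₁ m≤rank = inj₁ (m , s≤s (≤-trans m≤rank rank≤) , ran)
      ... | inj₂ (t , Z , t≤ , start , ran₁ , orbit) =
        inj₂ (t , s≤s (≤-trans t≤ (s≤s rank≤)) , Z , (ran₁ , start) , orbit)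

    compiled-bounded : ∀ X → AtMost (1 + orbit-bound) (Steps compiled X)
    compiled-bounded X =
      AtMost-⊆ compiled-reachable
        (AtMost-∪ (AtMost-one λ Y≡X Y′≡X → trans Y≡X (sym Y′≡X))
                  (AtMost-⋃unique (λ {T} {T′} (X≡T , _) (X≡T′ , c′∈) →
                                     toConfig-injective {T} {T′} c′∈ (trans (sym X≡T) X≡T′))
                                  (λ (_ , c∈) → AtMost-image (λ Y≡W Y′≡W → trans Y≡W (sym Y′≡W)) (orbit-bounded c∈))))

  bounded⇒compiled-bounded : UniformlyBounded S → UniformlyBounded compiled
  bounded⇒compiled-bounded (n , bounded) = 1 + orbit-bound , compiled-bounded
    where open Bounds n bounded

lemma4p27 : Σ (Machine → Machine) λ f →
    ∀ (S : Machine) → Deterministic S → LengthPreserving S →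
      Confluent (f S) × Simple (f S) × (UniformlyBounded S ⇔ UniformlyBounded (f S))
lemma4p27 = Simulator.compiled , λ S det lp →
  deterministic⇒confluent (Simulator.compiled-deterministic S) ,
  Simulator.compiled-simple S ,
  mk⇔ (Preservation.bounded⇒compiled-bounded S lp) (Reflection.compiled-bounded⇒bounded S lp det)
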